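{- Let $G$ be a graph and $k\in\{1,2,3\}$. Let $P = v_1 v_2\cdots v_k$ be a $k$-thread of $G$ with anchors $u$ and $w$, where $u \neq w$, $u$ is adjacent to $v_1$ and $w$ is adjacent to $v_k$. Let $\varphi$ be a partial proper coloring of $G$ with colors from $[4]$ whose domain $\mathsf{Dom}(\varphi)$ contains $u$ and $w$, such that an odd color $\varphi_{\mathsf{o}}(w)$ of $w$ exists, and such that if $\varphi(v_k)$ is defined then $\varphi_{\mathsf{o}}(w)\neq \varphi(v_k)$. Suppose that $P$ is $(u,\varphi)$-flexible, i.e. one of the following holds: (i) $k=1$ and $\varphi(u)=\varphi_{\mathsf{o}}(w)$; (ii) $k=2$ and $\varphi(u)=\varphi(w)$ or $\varphi(u)=\varphi_{\mathsf{o}}(w)$; (iii) $k=3$ and $\varphi(u)\neq\varphi_{\mathsf{o}}(w)$. Then there exist two proper colorings $\varphi'$ and $\varphi''$, with colors from $[4]$, of the vertex set $\mathsf{Dom}(\varphi)\cup V(P)$ such that: (1) $\varphi(x)=\varphi'(x)=\varphi''(x)$ for all $x\in \mathsf{Dom}(\varphi)\setminus V(P)$; (2) for every $x \in V(P)\cup\{w\}$, an odd color of $x$ exists under $\varphi'$ and an odd color of $x$ exists under $\varphi''$; (3) $\varphi'(v_1)\neq\varphi''(v_1)$.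
   Context: A $k$-thread is a path $v_1\cdots v_k$ in $G$ all of whose vertices have degree exactly $2$ in $G$, such that the neighbor $u$ of $v_1$ not on the path and the neighbor $w$ of $v_k$ not on the path both have degree at least $3$; $u$ and $w$ are called the anchors. A partial proper coloring is a proper coloring of the subgraph induced by some subset $\mathsf{Dom}(\varphi)$ of vertices. For a (partial) coloring $\psi$ and a vertex $x$, an odd color of $x$, written $\psi_{\mathsf{o}}(x)$, is a color that appears an odd number of times among the colors of the colored neighbors of $x$ (if such a color exists). -}

module Defs where

open import Data.Nat using (ℕ; suc; _≥_; parity)
open import Data.Parity.Base using (1ℙ)
open import Data.Fin using (Fin; zero; suc; fromℕ; inject₁)
open import Data.List using (List; length; filter)
open import Data.List.Base using ()
open import Data.Fin.Base using ()
open import Data.Vec.Functional using ()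
open import Data.Maybe using (Maybe; just)
open import Data.Maybe.Properties using (≡-dec)
open import Data.Fin.Properties using (_≟_)
open import Data.Product using (Σ; ∃; ∃-syntax; _×_; _,_)
open import Data.Sum using (_⊎_)
open import Data.Empty using (⊥)
open import Relation.Nullary using (¬_; Dec)
open import Relation.Nullary.Decidable using (_×-dec_)
open import Relation.Binary.PropositionalEquality using (_≡_; _≢_)
open import Function.Definitions using (Injective)

record Graph (n : ℕ) : Set₁ where
  field
    Adj     : Fin n → Fin n → Set
    adj?    : (x y : Fin n) → Dec (Adj x y)
    sym     : ∀ {x y} → Adj x y → Adj y x
    irrefl  : ∀ {x} → ¬ Adj x x

open Graph public

allVertices : (n : ℕ) → List (Fin n)
allVertices n = Data.List.Base.tabulate (λ i → i)
  where import Data.List.Base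

deg : ∀ {n} → Graph n → Fin n → ℕ
deg {n} G x = length (filter (adj? G x) (allVertices n))

PartialColoring : ℕ → Set
PartialColoring n = Fin n → Maybe (Fin 4)

_∈Dom_ : ∀ {n} → Fin n → PartialColoring n → Set
x ∈Dom φ = ∃[ c ] φ x ≡ just c

Proper : ∀ {n} → Graph n → PartialColoring n → Set
Proper G φ = ∀ x y a b → Adj G x y → φ x ≡ just a → φ y ≡ just b → a ≢ b

colourCount : ∀ {n} → Graph n → PartialColoring n → Fin n → Fin 4 → ℕ
colourCount {n} G ψ x c =
  length (filter (λ y → adj? G x y ×-dec ≡-dec _≟_ (ψ y) (just c)) (allVertices n))

IsOddColor : ∀ {n} → Graph n → PartialColoring n → Fin n → Fin 4 → Set
IsOddColor G ψ x c = parity (colourCount G ψ x c) ≡ 1ℙ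

HasOddColor : ∀ {n} → Graph n → PartialColoring n → Fin n → Set
HasOddColor G ψ x = ∃[ c ] IsOddColor G ψ x c

OnPath : ∀ {n m} → (Fin (suc m) → Fin n) → Fin n → Set
OnPath v x = ∃[ i ] v i ≡ x

-- P = v₁ ⋯ v_k (k = suc m, vᵢ₊₁ = v i) is a k-thread of G with anchors u
-- (neighbour of v₁ off the path) and w (neighbour of v_k off the path).
record IsThread {n m : ℕ} (G : Graph n) (v : Fin (suc m) → Fin n) (u w : Fin n) : Set where
  field
    distinct   : Injective _≡_ _≡_ v
    path       : ∀ (i : Fin m) → Adj G (v (inject₁ i)) (v (suc i))
    deg2       : ∀ i → deg G (v i) ≡ 2
    u-adj      : Adj G u (v zero)
    w-adj      : Adj G w (v (fromℕ m))
    u-off      : ¬ OnPath v u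
    w-off      : ¬ OnPath v w
    u-deg      : deg G u ≥ 3
    w-deg      : deg G w ≥ 3

HasDomainDomPath : ∀ {n m} → PartialColoring n → (Fin (suc m) → Fin n) → PartialColoring n → Set
HasDomainDomPath φ v ψ = ∀ x → (x ∈Dom ψ → (x ∈Dom φ ⊎ OnPath v x)) × ((x ∈Dom φ ⊎ OnPath v x) → x ∈Dom ψ)

{-# OPTIONS --safe #-}

-- Only the thread is recoloured. Each vᵢ has exactly two neighbours, the vertices just before
-- and just after it on the walk u v₁ ⋯ v_k w, so vᵢ has an odd colour as soon as these two get
-- different colours. The only thread vertex adjacent to w is v_k, so w keeps its odd colour c
-- provided v_k is coloured c neither before nor after. A valid recolouring is therefore a
-- sequence φ(u), x₁, …, x_k, φ(w) in which any three consecutive colours are distinct and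
-- x_k ≠ c. With four colours and k ≤ 3, flexibility (together with c ≠ φ(w), which holds
-- because no neighbour of w has colour φ(w)) leaves room for two such sequences with
-- different x₁.

module Submission where

open import Defs renaming (sym to Adj-sym)
open import Data.Nat using (ℕ; zero; suc; _≤_; parity)
open import Data.Parity.Base using (1ℙ)
open import Data.Fin using (Fin; zero; suc; fromℕ; inject₁)
open import Data.Fin.Properties using (_≟_; any?; all?; suc-injective; 0≢1+n)
open import Data.List using (List; []; _∷_; length; filter; tabulate)
open import Data.List.Properties using (filter-accept; filter-reject; filter-none; filter-≐)
open import Data.List.Relation.Unary.All.Properties using (tabulate⁺)
open import Data.List.Relation.Unary.Any using (here; there)
open import Data.List.Membership.Propositional using (_∈_)
open import Data.List.Membership.Propositional.Properties using (∈-filter⁺; ∈-tabulate⁺)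
open import Data.Vec using (_∷_; []; lookup)
open import Data.Maybe using (just)
open import Data.Maybe.Properties using (just-injective; ≡-dec)
open import Data.Product using (Σ; ∃₂; _×_; _,_; _,′_; proj₁; proj₂)
open import Data.Sum using (_⊎_; inj₁; inj₂)
open import Data.Empty using (⊥-elim)
open import Function using (_∘_; id; case_of_)
open import Function.Definitions using (Injective)
open import Relation.Nullary using (¬_; Dec; yes; no; ¬?)
open import Relation.Nullary.Decidable using (_×-dec_; from-yes)
open import Relation.Unary using (Pred; Decidable)
open import Relation.Binary.PropositionalEquality
  using (_≡_; _≢_; refl; sym; trans; cong; subst; ≢-sym)

≡just-unique : ∀ {A : Set} {m} {x y : A} → m ≡ just x → m ≡ just y → x ≡ y
≡just-unique m≡x m≡y = just-injective (trans (sym m≡x) m≡y)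

∈-pair⁻ : ∀ {A : Set} {p q y : A} → y ∈ p ∷ q ∷ [] → y ≡ p ⊎ y ≡ q
∈-pair⁻ (here y≡p)         = inj₁ y≡p
∈-pair⁻ (there (here y≡q)) = inj₂ y≡q

length≡2⇒∈-distinct-pair : ∀ {A : Set} (xs : List A) {l r y : A} → length xs ≡ 2 →
  l ∈ xs → r ∈ xs → y ∈ xs → l ≢ r → y ≡ l ⊎ y ≡ r
length≡2⇒∈-distinct-pair (p ∷ q ∷ []) refl l∈ r∈ y∈ l≢r
  with ∈-pair⁻ l∈ | ∈-pair⁻ r∈ | ∈-pair⁻ y∈
... | inj₁ refl | inj₁ refl | _         = ⊥-elim (l≢r refl)
... | inj₂ refl | inj₂ refl | _         = ⊥-elim (l≢r refl)
... | inj₁ refl | inj₂ refl | inj₁ refl = inj₁ refl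
... | inj₁ refl | inj₂ refl | inj₂ refl = inj₂ refl
... | inj₂ refl | inj₁ refl | inj₁ refl = inj₂ refl
... | inj₂ refl | inj₁ refl | inj₂ refl = inj₁ refl

module _ {a p} {A : Set a} {P : Pred A p} (P? : Decidable P) where

  length-filter-tabulate-unique : ∀ {k} (f : Fin k → A) {i : Fin k} →
    P (f i) → (∀ j → P (f j) → j ≡ i) → length (filter P? (tabulate f)) ≡ 1
  length-filter-tabulate-unique {suc k} f {zero} P[f0] unique =
    trans (cong length (filter-accept P? P[f0]))
          (cong (suc ∘ length) (filter-none P?
            (tabulate⁺ λ j P[fj] → 0≢1+n (sym (unique (suc j) P[fj])))))
  length-filter-tabulate-unique {suc k} f {suc i} P[fi] unique =
    trans (cong length (filter-reject P? {f zero} λ P[f0] → 0≢1+n (unique zero P[f0])))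
          (length-filter-tabulate-unique (f ∘ suc) P[fi]
            (λ j P[fj] → suc-injective (unique (suc j) P[fj])))

module _ {n} (G : Graph n) where

  coloured-neighbour? : (ψ : PartialColoring n) (x : Fin n) (c : Fin 4) →
    Decidable (λ y → Adj G x y × ψ y ≡ just c)
  coloured-neighbour? ψ x c y = adj? G x y ×-dec ≡-dec _≟_ (ψ y) (just c)

  ∈-neighbours : ∀ {x y} → Adj G x y → y ∈ filter (adj? G x) (allVertices n)
  ∈-neighbours {x} {y} xy = ∈-filter⁺ (adj? G x) (∈-tabulate⁺ y) xy

  degree-two-neighbours : ∀ {x l r y} → deg G x ≡ 2 →
    Adj G x l → Adj G x r → l ≢ r → Adj G x y → y ≡ l ⊎ y ≡ r
  degree-two-neighbours {x} deg≡2 xl xr l≢r xy =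
    length≡2⇒∈-distinct-pair (filter (adj? G x) (allVertices n)) deg≡2
      (∈-neighbours xl) (∈-neighbours xr) (∈-neighbours xy) l≢r

  isOddColor-unique : ∀ {ψ x p α} → Adj G x p → ψ p ≡ just α →
    (∀ {y} → Adj G x y → ψ y ≡ just α → y ≡ p) → IsOddColor G ψ x α
  isOddColor-unique {ψ} {x} {α = α} xp ψp unique =
    cong parity (length-filter-tabulate-unique (coloured-neighbour? ψ x α) id (xp , ψp)
      λ y (xy , ψy) → unique xy ψy)

  colourCount-cong : ∀ {φ ψ x c} →
    (∀ {y} → Adj G x y → ψ y ≡ just c → φ y ≡ just c) →
    (∀ {y} → Adj G x y → φ y ≡ just c → ψ y ≡ just c) →
    colourCount G ψ x c ≡ colourCount G φ x c
  colourCount-cong {φ} {ψ} {x} {c} to from =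
    cong length (filter-≐ (coloured-neighbour? ψ x c) (coloured-neighbour? φ x c)
      ((λ (xy , ψy) → xy , to xy ψy) , (λ (xy , φy) → xy , from xy φy)) (allVertices n))

  oddColor≢own : ∀ {φ x b c} → Proper G φ → φ x ≡ just b → IsOddColor G φ x c → c ≢ b
  oddColor≢own {φ} {x} {b} φ-proper φx c-odd refl =
    case subst (λ k → parity k ≡ 1ℙ) no-neighbour-coloured-b c-odd of λ ()
    where
    no-neighbour-coloured-b : colourCount G φ x b ≡ 0
    no-neighbour-coloured-b = cong length (filter-none (coloured-neighbour? φ x b)
      (tabulate⁺ λ y (xy , φy) → φ-proper x y b b xy φx φy refl))

onPath? : ∀ {n m} (v : Fin (suc m) → Fin n) (x : Fin n) → Dec (OnPath v x)
onPath? v x = any? λ i → v i ≟ x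

recolour : ∀ {n m} → PartialColoring n → (Fin (suc m) → Fin n) → (Fin (suc m) → Fin 4) →
  PartialColoring n
recolour φ v col x with onPath? v x
... | yes (i , _) = just (col i)
... | no _        = φ x

module Recolouring {n m} {v : Fin (suc m) → Fin n} (v-injective : Injective _≡_ _≡_ v)
  (φ : PartialColoring n) (col : Fin (suc m) → Fin 4) where

  ψ : PartialColoring n
  ψ = recolour φ v col

  recolour-onPath : ∀ i → ψ (v i) ≡ just (col i)
  recolour-onPath i with onPath? v (v i)
  ... | yes (j , vj≡vi) = cong (just ∘ col) (v-injective vj≡vi)
  ... | no vi∉P         = ⊥-elim (vi∉P (i , refl))

  recolour-offPath : ∀ {x} → ¬ OnPath v x → ψ x ≡ φ x
  recolour-offPath {x} x∉P with onPath? v x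
  ... | yes x∈P = ⊥-elim (x∉P x∈P)
  ... | no _    = refl

  recolour-colour : ∀ i {γ} → ψ (v i) ≡ just γ → col i ≡ γ
  recolour-colour i ψvi = just-injective (trans (sym (recolour-onPath i)) ψvi)

  recolour-coloured : ∀ {x} → OnPath v x → x ∈Dom ψ
  recolour-coloured (i , refl) = col i , recolour-onPath i

  recolour-domain : HasDomainDomPath φ v ψ
  recolour-domain x = to , from
    where
    to : x ∈Dom ψ → x ∈Dom φ ⊎ OnPath v x
    to (d , ψx) = case onPath? v x of λ where
      (yes x∈P) → inj₂ x∈P
      (no x∉P)  → inj₁ (d , trans (sym (recolour-offPath x∉P)) ψx)
    from : x ∈Dom φ ⊎ OnPath v x → x ∈Dom ψ
    from (inj₂ x∈P) = recolour-coloured x∈P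
    from (inj₁ (d , φx)) = case onPath? v x of λ where
      (yes x∈P) → recolour-coloured x∈P
      (no x∉P)  → d , trans (recolour-offPath x∉P) φx

  recolour-proper : (G : Graph n) → Proper G φ →
    (∀ {x y α β} → OnPath v x → Adj G x y → ψ x ≡ just α → ψ y ≡ just β → α ≢ β) →
    Proper G ψ
  recolour-proper G φ-proper path-edge-proper x y α β xy ψx ψy =
    case onPath? v x ,′ onPath? v y of λ where
      (yes x∈P , _)     → path-edge-proper x∈P xy ψx ψy
      (no _ , yes y∈P)  → ≢-sym (path-edge-proper y∈P (Adj-sym G xy) ψy ψx)
      (no x∉P , no y∉P) → φ-proper x y α β xy (trans (sym (recolour-offPath x∉P)) ψx)
                                              (trans (sym (recolour-offPath y∉P)) ψy)

-- The entries just before and just after f i in the sequence x, f 0, …, f m, y.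
before : ∀ {a} {A : Set a} {m} → A → (Fin (suc m) → A) → Fin (suc m) → A
before x f zero    = x
before x f (suc i) = f (inject₁ i)

after : ∀ {a} {A : Set a} {m} → A → (Fin (suc m) → A) → Fin (suc m) → A
after {m = zero}  y f zero    = y
after {m = suc m} y f zero    = f (suc zero)
after {m = suc m} y f (suc i) = after y (f ∘ suc) i

module _ {a b c} {A : Set a} {B : Set b} {C : Set c} (h : A → C) (g : B → C) where

  before-natural : ∀ {m x x′} {f : Fin (suc m) → A} {f′ : Fin (suc m) → B} →
    h x ≡ g x′ → (∀ j → h (f j) ≡ g (f′ j)) → ∀ i → h (before x f i) ≡ g (before x′ f′ i)
  before-natural hx hf zero    = hx
  before-natural hx hf (suc i) = hf (inject₁ i)

  after-natural : ∀ {m y y′} {f : Fin (suc m) → A} {f′ : Fin (suc m) → B} →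
    h y ≡ g y′ → (∀ j → h (f j) ≡ g (f′ j)) → ∀ i → h (after y f i) ≡ g (after y′ f′ i)
  after-natural {zero}  hy hf zero    = hy
  after-natural {suc m} hy hf zero    = hf (suc zero)
  after-natural {suc m} hy hf (suc i) = after-natural hy (hf ∘ suc) i

module _ {a} {A : Set a} where

  after-related : ∀ {r} {R : A → A → Set r} {m y} {f : Fin (suc m) → A} →
    (∀ j → R (f (inject₁ j)) (f (suc j))) → R (f (fromℕ m)) y → ∀ i → R (f i) (after y f i)
  after-related {m = zero}  path last zero    = last
  after-related {m = suc m} path last zero    = path zero
  after-related {R = R} {m = suc m} path last (suc i) = after-related {R = R} (path ∘ suc) last i

  after≡⇒last : ∀ {m y} {f : Fin (suc m) → A} → (∀ j → f j ≢ y) →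
    ∀ i → after y f i ≡ y → i ≡ fromℕ m
  after≡⇒last {zero}  f≢y zero    _  = refl
  after≡⇒last {suc m} f≢y zero    eq = ⊥-elim (f≢y (suc zero) eq)
  after≡⇒last {suc m} f≢y (suc i) eq = cong suc (after≡⇒last (f≢y ∘ suc) i eq)

Distinct₃ : ∀ {a} {A : Set a} → A → A → A → Set a
Distinct₃ x y z = x ≢ y × y ≢ z × x ≢ z

record ThreadColouring {m} (a b c : Fin 4) (col : Fin (suc m) → Fin 4) : Set where
  field
    windows-distinct : ∀ i → Distinct₃ (before a col i) (col i) (after b col i)
    last≢c           : col (fromℕ m) ≢ c

  before≢col : ∀ i → before a col i ≢ col i
  before≢col i = proj₁ (windows-distinct i)

  col≢after : ∀ i → col i ≢ after b col i
  col≢after i = proj₁ (proj₂ (windows-distinct i))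

  before≢after : ∀ i → before a col i ≢ after b col i
  before≢after i = proj₂ (proj₂ (windows-distinct i))

module ThreadRecolouring
  {n m} {G : Graph n} {v : Fin (suc m) → Fin n} {u w : Fin n}
  (T : IsThread G v u w) (u≢w : u ≢ w)
  {φ : PartialColoring n} (φ-proper : Proper G φ)
  {a b : Fin 4} (φu : φ u ≡ just a) (φw : φ w ≡ just b)
  {c : Fin 4} (c-odd : IsOddColor G φ w c) (φ-last : ∀ d → φ (v (fromℕ m)) ≡ just d → c ≢ d)
  {col : Fin (suc m) → Fin 4} (valid : ThreadColouring a b c col)
  where

  open IsThread T
  open ThreadColouring valid
  open Recolouring distinct φ col public

  ψ-before : ∀ i → ψ (before u v i) ≡ just (before a col i)
  ψ-before = before-natural ψ just (trans (recolour-offPath u-off) φu) recolour-onPath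

  ψ-after : ∀ i → ψ (after w v i) ≡ just (after b col i)
  ψ-after = after-natural ψ just (trans (recolour-offPath w-off) φw) recolour-onPath

  adj-before : ∀ i → Adj G (v i) (before u v i)
  adj-before zero    = Adj-sym G u-adj
  adj-before (suc i) = Adj-sym G (path i)

  adj-after : ∀ i → Adj G (v i) (after w v i)
  adj-after = after-related {R = Adj G} path (Adj-sym G w-adj)

  neighbours-distinct : ∀ i → before u v i ≢ after w v i
  neighbours-distinct i eq =
    before≢after i (≡just-unique (trans (cong ψ (sym eq)) (ψ-before i)) (ψ-after i))

  neighbours : ∀ i {y} → Adj G (v i) y → y ≡ before u v i ⊎ y ≡ after w v i
  neighbours i =
    degree-two-neighbours G (deg2 i) (adj-before i) (adj-after i) (neighbours-distinct i)

  proper : Proper G ψ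
  proper = recolour-proper G φ-proper path-edge-proper
    where
    path-edge-proper : ∀ {x y α β} → OnPath v x → Adj G x y → ψ x ≡ just α → ψ y ≡ just β → α ≢ β
    path-edge-proper (i , refl) xy ψx ψy α≡β with neighbours i xy
    ... | inj₁ refl =
      before≢col i
        (sym (trans (recolour-colour i ψx) (trans α≡β (≡just-unique ψy (ψ-before i)))))
    ... | inj₂ refl =
      col≢after i (trans (recolour-colour i ψx) (trans α≡β (≡just-unique ψy (ψ-after i))))

  odd-on-path : ∀ i → HasOddColor G ψ (v i)
  odd-on-path i = before a col i , isOddColor-unique G (adj-before i) (ψ-before i) unique
    where
    unique : ∀ {y} → Adj G (v i) y → ψ y ≡ just (before a col i) → y ≡ before u v i
    unique iy ψy with neighbours i iy
    ... | inj₁ y≡before = y≡before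
    ... | inj₂ refl     = ⊥-elim (before≢after i (≡just-unique ψy (ψ-after i)))

  w-neighbour-is-last : ∀ i → Adj G w (v i) → i ≡ fromℕ m
  w-neighbour-is-last i wi with neighbours i (Adj-sym G wi)
  w-neighbour-is-last zero    _ | inj₁ w≡u  = ⊥-elim (u≢w (sym w≡u))
  w-neighbour-is-last (suc j) _ | inj₁ w≡vj = ⊥-elim (w-off (inject₁ j , sym w≡vj))
  ... | inj₂ w≡after = after≡⇒last (λ j vj≡w → w-off (j , vj≡w)) i (sym w≡after)

  path-neighbour-of-w-not-c : ∀ {y} → OnPath v y → Adj G w y → ψ y ≢ just c × φ y ≢ just c
  path-neighbour-of-w-not-c (i , refl) wi with w-neighbour-is-last i wi
  ... | refl = (λ ψvi → last≢c (recolour-colour _ ψvi)) , (λ φvi → φ-last c φvi refl)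

  odd-at-w : IsOddColor G ψ w c
  odd-at-w = trans (cong parity (colourCount-cong G to from)) c-odd
    where
    to : ∀ {y} → Adj G w y → ψ y ≡ just c → φ y ≡ just c
    to {y} wy ψy = case onPath? v y of λ where
      (yes y∈P) → ⊥-elim (proj₁ (path-neighbour-of-w-not-c y∈P wy) ψy)
      (no y∉P)  → trans (sym (recolour-offPath y∉P)) ψy
    from : ∀ {y} → Adj G w y → φ y ≡ just c → ψ y ≡ just c
    from {y} wy φy = case onPath? v y of λ where
      (yes y∈P) → ⊥-elim (proj₂ (path-neighbour-of-w-not-c y∈P wy) φy)
      (no y∉P)  → trans (recolour-offPath y∉P) φy

  odd : ∀ x → OnPath v x ⊎ x ≡ w → HasOddColor G ψ x
  odd _ (inj₁ (i , refl)) = odd-on-path i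
  odd _ (inj₂ refl)       = c , odd-at-w

two-other-colours : (p q : Fin 4) → ∃₂ λ x y → x ≢ p × x ≢ q × y ≢ p × y ≢ q × x ≢ y
two-other-colours = from-yes (all? {4} λ p → all? {4} λ q → any? {4} λ x → any? {4} λ y →
  ¬? (x ≟ p) ×-dec ¬? (x ≟ q) ×-dec ¬? (y ≟ p) ×-dec ¬? (y ≟ q) ×-dec ¬? (x ≟ y))

TwoThreadColourings : (m : ℕ) (a b c : Fin 4) → Set
TwoThreadColourings m a b c = ∃₂ λ (col₁ col₂ : Fin (suc m) → Fin 4) →
  ThreadColouring a b c col₁ × ThreadColouring a b c col₂ × col₁ zero ≢ col₂ zero

two-thread-colourings₀ : ∀ {a b c} → a ≡ c → c ≢ b → TwoThreadColourings 0 a b c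
two-thread-colourings₀ {a} {b} refl a≢b with two-other-colours a b
... | x₁ , x₂ , x₁≢a , x₁≢b , x₂≢a , x₂≢b , x₁≢x₂ =
  lookup (x₁ ∷ []) , lookup (x₂ ∷ []) , colouring x₁≢a x₁≢b , colouring x₂≢a x₂≢b , x₁≢x₂
  where
  colouring : ∀ {x} → x ≢ a → x ≢ b → ThreadColouring a b a (lookup (x ∷ []))
  colouring x≢a x≢b = record
    { windows-distinct = λ { zero → ≢-sym x≢a , x≢b , a≢b }
    ; last≢c           = x≢a
    }

thread-colouring₁ : ∀ {a b c x y} → x ≢ a → x ≢ b → y ≢ a → y ≢ b → x ≢ y → y ≢ c →
  ThreadColouring a b c (lookup (x ∷ y ∷ []))
thread-colouring₁ x≢a x≢b y≢a y≢b x≢y y≢c = record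
  { windows-distinct = λ { zero       → ≢-sym x≢a , x≢y , ≢-sym y≢a
                         ; (suc zero) → x≢y , y≢b , x≢b }
  ; last≢c           = y≢c
  }

two-thread-colourings₁ : ∀ {a b c} → a ≡ b ⊎ a ≡ c → TwoThreadColourings 1 a b c
two-thread-colourings₁ {a} {c = c} (inj₁ refl) with two-other-colours a c
... | y , _ , y≢a , y≢c , _ with two-other-colours a y
...   | x₁ , x₂ , x₁≢a , x₁≢y , x₂≢a , x₂≢y , x₁≢x₂ =
  lookup (x₁ ∷ y ∷ []) , lookup (x₂ ∷ y ∷ []) ,
  thread-colouring₁ x₁≢a x₁≢a y≢a y≢a x₁≢y y≢c ,
  thread-colouring₁ x₂≢a x₂≢a y≢a y≢a x₂≢y y≢c , x₁≢x₂
two-thread-colourings₁ {a} {b} (inj₂ refl) with two-other-colours a b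
... | y₁ , y₂ , y₁≢a , y₁≢b , y₂≢a , y₂≢b , y₁≢y₂ =
  lookup (y₂ ∷ y₁ ∷ []) , lookup (y₁ ∷ y₂ ∷ []) ,
  thread-colouring₁ y₂≢a y₂≢b y₁≢a y₁≢b (≢-sym y₁≢y₂) y₁≢a ,
  thread-colouring₁ y₁≢a y₁≢b y₂≢a y₂≢b y₁≢y₂ y₂≢a , ≢-sym y₁≢y₂

thread-colouring₂ : ∀ {a b c x y z} → x ≢ a → y ≢ a → x ≢ y → x ≢ z → y ≢ z → y ≢ b →
  z ≢ b → z ≢ c → ThreadColouring a b c (lookup (x ∷ y ∷ z ∷ []))
thread-colouring₂ x≢a y≢a x≢y x≢z y≢z y≢b z≢b z≢c = record
  { windows-distinct = λ { zero             → ≢-sym x≢a , x≢y , ≢-sym y≢a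
                         ; (suc zero)       → x≢y , y≢z , x≢z
                         ; (suc (suc zero)) → y≢z , z≢b , y≢b }
  ; last≢c           = z≢c
  }

swapped-thread-colourings₂ : ∀ {a b c x y z} → x ≢ a → y ≢ a → x ≢ b → y ≢ b → x ≢ y →
  x ≢ z → y ≢ z → z ≢ b → z ≢ c → TwoThreadColourings 2 a b c
swapped-thread-colourings₂ {x = x} {y} {z} x≢a y≢a x≢b y≢b x≢y x≢z y≢z z≢b z≢c =
  lookup (x ∷ y ∷ z ∷ []) , lookup (y ∷ x ∷ z ∷ []) ,
  thread-colouring₂ x≢a y≢a x≢y x≢z y≢z y≢b z≢b z≢c ,
  thread-colouring₂ y≢a x≢a (≢-sym x≢y) y≢z x≢z x≢b z≢b z≢c , x≢y

two-thread-colourings₂ : ∀ {a b c} → a ≢ c → TwoThreadColourings 2 a b c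
two-thread-colourings₂ {a} {b} {c} a≢c with a ≟ b
... | no a≢b with two-other-colours a b
...   | x , y , x≢a , x≢b , y≢a , y≢b , x≢y =
  swapped-thread-colourings₂ x≢a y≢a x≢b y≢b x≢y x≢a y≢a a≢b a≢c
two-thread-colourings₂ {a} {c = c} a≢c | yes refl with two-other-colours a c
... | z , _ , z≢a , z≢c , _ with two-other-colours z a
...   | x , y , x≢z , x≢a , y≢z , y≢a , x≢y =
  swapped-thread-colourings₂ x≢a y≢a x≢a y≢a x≢y x≢z y≢z z≢a z≢c

-- (u, φ)-flexibility of a k-thread, for k = m + 1, a = φ(u), b = φ(w) and c = φₒ(w).
Flexible : ℕ → (a b c : Fin 4) → Set
Flexible m a b c = (m ≡ 0 × a ≡ c) ⊎ (m ≡ 1 × (a ≡ b ⊎ a ≡ c)) ⊎ (m ≡ 2 × a ≢ c)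

two-thread-colourings : ∀ {m a b c} → Flexible m a b c → c ≢ b → TwoThreadColourings m a b c
two-thread-colourings (inj₁ (refl , a≡c))             c≢b = two-thread-colourings₀ a≡c c≢b
two-thread-colourings (inj₂ (inj₁ (refl , a≡b⊎a≡c))) _   = two-thread-colourings₁ a≡b⊎a≡c
two-thread-colourings (inj₂ (inj₂ (refl , a≢c)))     _   = two-thread-colourings₂ a≢c

lemma4p4 : ∀ {n} (G : Graph n) (m : ℕ) → m ≤ 2 →
    (v : Fin (suc m) → Fin n) (u w : Fin n) →
    IsThread G v u w → u ≢ w →
    (φ : PartialColoring n) → Proper G φ →
    (a b : Fin 4) → φ u ≡ just a → φ w ≡ just b →
    (c : Fin 4) → IsOddColor G φ w c →
    (∀ d → φ (v (fromℕ m)) ≡ just d → c ≢ d) →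
    ((m ≡ 0 × a ≡ c) ⊎ (m ≡ 1 × (a ≡ b ⊎ a ≡ c)) ⊎ (m ≡ 2 × a ≢ c)) →
    Σ (PartialColoring n) λ φ′ → Σ (PartialColoring n) λ φ″ →
      HasDomainDomPath φ v φ′ × HasDomainDomPath φ v φ″ ×
      Proper G φ′ × Proper G φ″ ×
      (∀ x → x ∈Dom φ → ¬ OnPath v x → (φ′ x ≡ φ x × φ″ x ≡ φ x)) ×
      (∀ x → (OnPath v x ⊎ x ≡ w) → HasOddColor G φ′ x × HasOddColor G φ″ x) ×
      φ′ (v zero) ≢ φ″ (v zero)
-- The hypothesis m ≤ 2 is implied by flexibility.
lemma4p4 G m _ v u w T u≢w φ φ-proper a b φu φw c c-odd φ-last flexible
  with two-thread-colourings flexible (oddColor≢own G φ-proper φw c-odd)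
... | col₁ , col₂ , valid₁ , valid₂ , col₁≢col₂ =
  E₁.ψ , E₂.ψ , E₁.recolour-domain , E₂.recolour-domain , E₁.proper , E₂.proper ,
  (λ _ _ x∉P → E₁.recolour-offPath x∉P , E₂.recolour-offPath x∉P) ,
  (λ x x∈P∪w → E₁.odd x x∈P∪w , E₂.odd x x∈P∪w) ,
  λ ψ₁≡ψ₂ → col₁≢col₂
    (≡just-unique (trans (sym ψ₁≡ψ₂) (E₁.recolour-onPath zero)) (E₂.recolour-onPath zero))
  where
  module E₁ = ThreadRecolouring T u≢w φ-proper φu φw c-odd φ-last valid₁
  module E₂ = ThreadRecolouring T u≢w φ-proper φu φw c-odd φ-last valid₂
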